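{- Let $\mathcal{C}_1,\dots,\mathcal{C}_t$ be intersectionwise $\chi$-guarding classes. Then their graph-union, i.e. the class of all graphs $G_1\cup\dots\cup G_t$ with $G_i\in\mathcal{C}_i$ for each $i\in[t]$, is intersectionwise $\chi$-guarding.
   Context: All graphs are finite and simple; graph classes are hereditary. The union of graphs $G_1,\dots,G_t$ is $(\bigcup V(G_i),\bigcup E(G_i))$. The graph-intersection of classes $\mathcal{A},\mathcal{B}$ is the class of all graphs $(V(G)\cap V(H),E(G)\cap E(H))$ with $G\in\mathcal{A}$, $H\in\mathcal{B}$. A class is $\chi$-bounded if there is a non-decreasing $f:\mathbb{N}\to\mathbb{N}$ with $\chi(G)\le f(\omega(G))$ for all members. A class $\mathcal{A}$ is intersectionwise $\chi$-guarding if for every $\chi$-bounded class $\mathcal{B}$ the graph-intersection of $\mathcal{A}$ and $\mathcal{B}$ is $\chi$-bounded. -}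

module Defs where

open import Data.Nat using (ℕ; zero; suc; _≤_; _<_; _⊔_)
open import Data.Nat.Properties using (m≤m⊔n; m≤n⊔m; ≤-trans)
open import Data.Bool using (Bool; true; false; _∨_; _∧_)
open import Data.Fin using (Fin)
import Data.Fin as F
open import Data.List using (List; length)
open import Data.List.Membership.Propositional using (_∈_)
open import Data.List.Relation.Unary.All using (All)
open import Data.List.Relation.Unary.Unique.Propositional using (Unique)
open import Data.Product using (Σ; _×_; _,_)
open import Data.Sum using (_⊎_; inj₁; inj₂)
open import Relation.Nullary using (¬_)
open import Relation.Binary.PropositionalEquality using (_≡_; _≢_; refl; cong₂)
open import Function using (_∘_)

record Graph : Set where
  field
    bound   : ℕ
    V       : ℕ → Bool
    E       : ℕ → ℕ → Bool
    V-bound : ∀ x → V x ≡ true → x < bound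
    E-sym   : ∀ x y → E x y ≡ E y x
    E-irr   : ∀ x → E x x ≡ false
    E-V     : ∀ x y → E x y ≡ true → V x ≡ true
open Graph public

∨-true : ∀ a b → a ∨ b ≡ true → (a ≡ true) ⊎ (b ≡ true)
∨-true true  b p = inj₁ refl
∨-true false b p = inj₂ p

∧-true₁ : ∀ a b → a ∧ b ≡ true → a ≡ true
∧-true₁ true b p = refl

∧-true₂ : ∀ a b → a ∧ b ≡ true → b ≡ true
∧-true₂ true b p = p

∨-mono : ∀ a b c d → (a ≡ true → c ≡ true) → (b ≡ true → d ≡ true) →
         a ∨ b ≡ true → c ∨ d ≡ true
∨-mono true  b true  d f g p = refl
∨-mono true  b false d f g p with f refl
... | ()
∨-mono false b true  d f g p = refl
∨-mono false b false d f g p = g p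

∨-false : ∀ a b → a ≡ false → b ≡ false → a ∨ b ≡ false
∨-false false false refl refl = refl

∧-false : ∀ a b → a ≡ false → a ∧ b ≡ false
∧-false false b refl = refl

emptyGraph : Graph
emptyGraph = record
  { bound = 0 ; V = λ _ → false ; E = λ _ _ → false
  ; V-bound = λ x () ; E-sym = λ _ _ → refl ; E-irr = λ _ → refl
  ; E-V = λ _ _ () }

_∪G_ : Graph → Graph → Graph
G ∪G H = record
  { bound = bound G ⊔ bound H
  ; V = λ x → V G x ∨ V H x
  ; E = λ x y → E G x y ∨ E H x y
  ; V-bound = λ x p → lem x (∨-true (V G x) (V H x) p)
  ; E-sym = λ x y → cong₂ _∨_ (E-sym G x y) (E-sym H x y)
  ; E-irr = λ x → ∨-false (E G x x) (E H x x) (E-irr G x) (E-irr H x)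
  ; E-V = λ x y → ∨-mono (E G x y) (E H x y) (V G x) (V H x)
                         (E-V G x y) (E-V H x y)
  }
  where
  lem : ∀ x → (V G x ≡ true) ⊎ (V H x ≡ true) → x < bound G ⊔ bound H
  lem x (inj₁ p) = ≤-trans (V-bound G x p) (m≤m⊔n (bound G) (bound H))
  lem x (inj₂ p) = ≤-trans (V-bound H x p) (m≤n⊔m (bound G) (bound H))

_∩G_ : Graph → Graph → Graph
G ∩G H = record
  { bound = bound G
  ; V = λ x → V G x ∧ V H x
  ; E = λ x y → E G x y ∧ E H x y
  ; V-bound = λ x p → V-bound G x (∧-true₁ (V G x) (V H x) p)
  ; E-sym = λ x y → cong₂ _∧_ (E-sym G x y) (E-sym H x y)
  ; E-irr = λ x → ∧-false (E G x x) (E H x x) (E-irr G x)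
  ; E-V = λ x y p → lem (E-V G x y (∧-true₁ (E G x y) (E H x y) p))
                        (E-V H x y (∧-true₂ (E G x y) (E H x y) p))
  }
  where
  lem : ∀ {a b} → a ≡ true → b ≡ true → a ∧ b ≡ true
  lem refl refl = refl

⋃G : (t : ℕ) → (Fin t → Graph) → Graph
⋃G zero    Gs = emptyGraph
⋃G (suc t) Gs = Gs F.zero ∪G ⋃G t (Gs ∘ F.suc)

induced : Graph → (ℕ → Bool) → Graph
induced G S = record
  { bound = bound G
  ; V = λ x → V G x ∧ S x
  ; E = λ x y → E G x y ∧ (S x ∧ S y)
  ; V-bound = λ x p → V-bound G x (∧-true₁ (V G x) (S x) p)
  ; E-sym = λ x y → cong₂ _∧_ (E-sym G x y) (∧-comm' (S x) (S y))
  ; E-irr = λ x → ∧-false (E G x x) (S x ∧ S x) (E-irr G x)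
  ; E-V = λ x y p → lem (E-V G x y (∧-true₁ (E G x y) _ p))
                        (∧-true₁ (S x) (S y) (∧-true₂ (E G x y) _ p))
  }
  where
  lem : ∀ {a b} → a ≡ true → b ≡ true → a ∧ b ≡ true
  lem refl refl = refl
  ∧-comm' : ∀ a b → a ∧ b ≡ b ∧ a
  ∧-comm' true true = refl
  ∧-comm' true false = refl
  ∧-comm' false true = refl
  ∧-comm' false false = refl

Iso : Graph → Graph → Set
Iso G H =
  Σ (ℕ → ℕ) λ f → Σ (ℕ → ℕ) λ g →
    (∀ x → V G x ≡ true → V H (f x) ≡ true) ×
    (∀ y → V H y ≡ true → V G (g y) ≡ true) ×
    (∀ x → V G x ≡ true → g (f x) ≡ x) ×
    (∀ y → V H y ≡ true → f (g y) ≡ y) ×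
    (∀ x y → V G x ≡ true → V G y ≡ true → E G x y ≡ E H (f x) (f y))

SameGraph : Graph → Graph → Set
SameGraph G H = (∀ x → V G x ≡ V H x) × (∀ x y → E G x y ≡ E H x y)

Class : Set₁
Class = Graph → Set

IsoClosed : Class → Set
IsoClosed C = ∀ G H → Iso G H → C G → C H

Hereditary : Class → Set
Hereditary C = ∀ G (S : ℕ → Bool) → C G → C (induced G S)

IsGraphClass : Class → Set
IsGraphClass C = IsoClosed C × Hereditary C

IsClique : Graph → List ℕ → Set
IsClique G xs = Unique xs × All (λ x → V G x ≡ true) xs ×
  (∀ x y → x ∈ xs → y ∈ xs → x ≢ y → E G x y ≡ true)

HasClique : Graph → ℕ → Set
HasClique G k = Σ (List ℕ) λ xs → length xs ≡ k × IsClique G xs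

CliqueNumber : Graph → ℕ → Set
CliqueNumber G w = HasClique G w × ¬ HasClique G (suc w)

Colourable : Graph → ℕ → Set
Colourable G k = Σ (ℕ → Fin k) λ c → ∀ x y → E G x y ≡ true → c x ≢ c y

NonDecreasing : (ℕ → ℕ) → Set
NonDecreasing f = ∀ m n → m ≤ n → f m ≤ f n

ChiBounded : Class → Set
ChiBounded C = Σ (ℕ → ℕ) λ f → NonDecreasing f ×
  (∀ G → C G → ∀ w → CliqueNumber G w → Colourable G (f w))

GraphIntersection : Class → Class → Class
GraphIntersection A B K =
  Σ Graph λ G → Σ Graph λ H → A G × B H × SameGraph K (G ∩G H)

GraphUnion : (t : ℕ) → (Fin t → Class) → Class
GraphUnion t Cs K =
  Σ (Fin t → Graph) λ Gs → (∀ i → Cs i (Gs i)) × SameGraph K (⋃G t Gs)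

IntersectionwiseChiGuarding : Class → Set₁
IntersectionwiseChiGuarding A =
  ∀ (B : Class) → IsGraphClass B → ChiBounded B →
    ChiBounded (GraphIntersection A B)

{-# OPTIONS --safe #-}
module Submission where

-- If K = (G₁ ∪ G₂) ∩ H, then K₁ = G₁ ∩ H and K₂ = G₂ ∩ H are subgraphs of K
-- whose edges cover those of K. Hence ω(Kᵢ) ≤ ω(K), each Kᵢ is coloured with
-- fᵢ(ω(K)) colours, and the product of the two colourings is a proper colouring
-- of K with f₁(ω(K)) · f₂(ω(K)) colours. Induction on t finishes the proof, the
-- empty union being edgeless. Since a χ-bound speaks only about the exact
-- clique number, ω(Kᵢ) has to be found, which is a finite search.

open import Defs
open import Data.Bool using (true; _∨_; _∧_)
open import Data.Bool.Properties using (∧-distribʳ-∨; ∨-zeroʳ) renaming (_≟_ to _≟ᵇ_)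
open import Data.Fin using (Fin; inject≤; combine)
import Data.Fin as Fin
open import Data.Fin.Properties using (inject≤-injective; combine-injective)
open import Data.List using (List; []; _∷_; length)
open import Data.List.Relation.Unary.All as All using (All; []; _∷_; all?)
open import Data.List.Relation.Unary.AllPairs using ([])
open import Data.Nat using (ℕ; zero; suc; _≤_; _<_; _*_; _≟_)
open import Data.List.Relation.Unary.Unique.DecPropositional _≟_ using (unique?)
open import Data.Nat.Properties using (anyUpTo?; *-mono-≤; ≤-refl; m≤n⇒m≤1+n; suc-injective)
open import Data.Product using (Σ; ∃-syntax; _×_; _,_; proj₁; proj₂)
open import Data.Sum using (_⊎_; inj₁; inj₂)
open import Function using (_∘_)
open import Relation.Nullary using (¬_; Dec; yes; no; ¬?; _×-dec_; _→-dec_)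
open import Relation.Nullary.Decidable using (map′)
open import Relation.Unary using (Decidable; _⊆′_)
open import Relation.Binary.PropositionalEquality using (_≡_; _≢_; refl; sym; trans; cong; cong₂)

private variable
  G G′ H K G₁ G₂ : Graph
  A : Class
  m n k w : ℕ
  x y : ℕ

∃-boundary : {P : ℕ → Set} → Decidable P → P 0 → ¬ P (suc w) →
  ∃[ v ] v ≤ w × P v × ¬ P (suc v)
∃-boundary {w = zero}  P? P0 ¬P1 = 0 , ≤-refl , P0 , ¬P1
∃-boundary {w = suc w} P? P0 ¬Pw+2 with P? (suc w)
... | yes Pw+1 = suc w , ≤-refl , Pw+1 , ¬Pw+2
... | no ¬Pw+1 with ∃-boundary P? P0 ¬Pw+1
...   | v , v≤w , Pv , ¬Pv+1 = v , m≤n⇒m≤1+n v≤w , Pv , ¬Pv+1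

∃-boundedList? : {P : List ℕ → Set} → Decidable P → ∀ b k →
  Dec (∃[ xs ] length xs ≡ k × All (_< b) xs × P xs)
∃-boundedList? {P} P? b zero = map′ (λ P[] → [] , refl , [] , P[]) nil (P? [])
  where
  nil : ∃[ xs ] length xs ≡ 0 × All (_< b) xs × P xs → P []
  nil ([] , _ , _ , P[]) = P[]
∃-boundedList? {P} P? b (suc k) =
  map′ cons uncons (anyUpTo? (λ x → ∃-boundedList? (P? ∘ (x ∷_)) b k) b)
  where
  cons : ∃[ x ] x < b × (∃[ xs ] length xs ≡ k × All (_< b) xs × P (x ∷ xs)) →
         ∃[ xs ] length xs ≡ suc k × All (_< b) xs × P xs
  cons (x , x<b , xs , refl , xs<b , Px∷xs) = x ∷ xs , refl , x<b ∷ xs<b , Px∷xs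
  uncons : ∃[ xs ] length xs ≡ suc k × All (_< b) xs × P xs →
           ∃[ x ] x < b × (∃[ xs ] length xs ≡ k × All (_< b) xs × P (x ∷ xs))
  uncons (x ∷ xs , len , x<b ∷ xs<b , Px∷xs) = x , x<b , xs , suc-injective len , xs<b , Px∷xs

isClique? : ∀ G → Decidable (IsClique G)
isClique? G xs =
  unique? xs ×-dec all? (λ x → V G x ≟ᵇ true) xs ×-dec
  map′ (λ adj x y x∈ y∈ → All.lookup (All.lookup adj x∈) y∈)
       (λ adj → All.tabulate λ x∈ → All.tabulate λ y∈ → adj _ _ x∈ y∈)
       (all? (λ x → all? (λ y → ¬? (x ≟ y) →-dec (E G x y ≟ᵇ true)) xs) xs)

hasClique? : ∀ G k → Dec (HasClique G k)
hasClique? G k = map′ (λ (xs , len , _ , clique) → xs , len , clique) bounded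
                      (∃-boundedList? (isClique? G) (bound G) k)
  where
  bounded : HasClique G k → ∃[ xs ] length xs ≡ k × All (_< bound G) xs × IsClique G xs
  bounded (xs , len , clique@(_ , inV , _)) =
    xs , len , All.map (λ {x} → V-bound G x) inV , clique

emptyClique : ∀ G → HasClique G 0
emptyClique _ = [] , refl , [] , [] , λ _ _ ()

cliqueNumber-≤ : ∀ G → ¬ HasClique G (suc w) → ∃[ v ] v ≤ w × CliqueNumber G v
cliqueNumber-≤ G = ∃-boundary (hasClique? G) (emptyClique G)

record _⊆G_ (G H : Graph) : Set where
  constructor subgraph
  field
    V-⊆ : ∀ x → V G x ≡ true → V H x ≡ true
    E-⊆ : ∀ x y → E G x y ≡ true → E H x y ≡ true
open _⊆G_

⊆G-trans : G ⊆G H → H ⊆G K → G ⊆G K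
⊆G-trans (subgraph GH-V GH-E) (subgraph HK-V HK-E) =
  subgraph (λ x → HK-V x ∘ GH-V x) (λ x y → HK-E x y ∘ GH-E x y)

SameGraph-refl : ∀ G → SameGraph G G
SameGraph-refl _ = (λ _ → refl) , (λ _ _ → refl)

SameGraph⇒⊆G : SameGraph G H → G ⊆G H
SameGraph⇒⊆G (sameV , sameE) =
  subgraph (λ x → trans (sym (sameV x))) (λ x y → trans (sym (sameE x y)))

SameGraph⇒⊇G : SameGraph G H → H ⊆G G
SameGraph⇒⊇G (sameV , sameE) =
  subgraph (λ x → trans (sameV x)) (λ x y → trans (sameE x y))

∪G-⊆ˡ : ∀ G H → G ⊆G (G ∪G H)
∪G-⊆ˡ G H = subgraph (λ x → cong (_∨ V H x)) (λ x y → cong (_∨ E H x y))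

∪G-⊆ʳ : ∀ G H → H ⊆G (G ∪G H)
∪G-⊆ʳ G H = subgraph (λ x p → trans (cong (V G x ∨_) p) (∨-zeroʳ _))
                     (λ x y p → trans (cong (E G x y ∨_) p) (∨-zeroʳ _))

∩G-⊆ˡ : ∀ G H → (G ∩G H) ⊆G G
∩G-⊆ˡ G H =
  subgraph (λ x → ∧-true₁ (V G x) (V H x)) (λ x y → ∧-true₁ (E G x y) (E H x y))

∩G-monoˡ : ∀ H → G ⊆G G′ → (G ∩G H) ⊆G (G′ ∩G H)
∩G-monoˡ {G} H (subgraph GG′-V GG′-E) = subgraph
  (λ x p → cong₂ _∧_ (GG′-V x (∧-true₁ (V G x) _ p)) (∧-true₂ (V G x) (V H x) p))
  (λ x y p → cong₂ _∧_ (GG′-E x y (∧-true₁ (E G x y) _ p)) (∧-true₂ (E G x y) (E H x y) p))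

∩G-∪G-edge : ∀ G₁ G₂ H → E ((G₁ ∪G G₂) ∩G H) x y ≡ true →
  E (G₁ ∩G H) x y ≡ true ⊎ E (G₂ ∩G H) x y ≡ true
∩G-∪G-edge {x} {y} G₁ G₂ H p =
  ∨-true _ _ (trans (sym (∧-distribʳ-∨ (E H x y) (E G₁ x y) (E G₂ x y))) p)

HasClique-mono : G ⊆G H → HasClique G k → HasClique H k
HasClique-mono (subgraph GH-V GH-E) (xs , len , unique , inV , adj) =
  xs , len , unique , All.map (GH-V _) inV ,
  λ x y x∈ y∈ x≢y → GH-E x y (adj x y x∈ y∈ x≢y)

Colourable-mono : ∀ G → m ≤ n → Colourable G m → Colourable G n
Colourable-mono _ m≤n (c , proper) =
  (λ x → inject≤ (c x) m≤n) ,
  λ x y Exy cx≡cy → proper x y Exy (inject≤-injective m≤n m≤n (c x) (c y) cx≡cy)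

Colourable-* : ∀ G G₁ G₂ →
  (∀ x y → E G x y ≡ true → E G₁ x y ≡ true ⊎ E G₂ x y ≡ true) →
  Colourable G₁ m → Colourable G₂ n → Colourable G (m * n)
Colourable-* G G₁ G₂ cover (c₁ , proper₁) (c₂ , proper₂) =
  (λ x → combine (c₁ x) (c₂ x)) , proper
  where
  proper : ∀ x y → E G x y ≡ true → combine (c₁ x) (c₂ x) ≢ combine (c₁ y) (c₂ y)
  proper x y Exy cx≡cy
    with combine-injective (c₁ x) (c₂ x) (c₁ y) (c₂ y) cx≡cy | cover x y Exy
  ... | c₁x≡c₁y , _ | inj₁ E₁xy = proper₁ x y E₁xy c₁x≡c₁y
  ... | _ , c₂x≡c₂y | inj₂ E₂xy = proper₂ x y E₂xy c₂x≡c₂y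

ChiBounded-colourable : (χ : ChiBounded A) → ∀ G → A G → ¬ HasClique G (suc w) →
  Colourable G (proj₁ χ w)
ChiBounded-colourable (f , f-mono , χ≤f∘ω) G AG ¬K with cliqueNumber-≤ G ¬K
... | v , v≤w , ωG≡v = Colourable-mono G (f-mono v _ v≤w) (χ≤f∘ω G AG v ωG≡v)

Guarding : Class → Set₁
Guarding = IntersectionwiseChiGuarding

Guarding-⊆ : ∀ A′ A → A′ ⊆′ A → Guarding A → Guarding A′
Guarding-⊆ _ _ A′⊆A guardA B isB χB with guardA B isB χB
... | f , f-mono , χ≤f∘ω =
  f , f-mono ,
  λ K (G , H , A′G , BH , K≡G∩H) → χ≤f∘ω K (G , H , A′⊆A G A′G , BH , K≡G∩H)

Edgeless : Graph → Set
Edgeless G = ∀ x y → E G x y ≢ true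

Edgeless-guarding : ∀ A → A ⊆′ Edgeless → Guarding A
Edgeless-guarding _ A⊆Edgeless B _ _ =
  (λ _ → 1) , (λ _ _ _ → ≤-refl) ,
  λ K (G , H , AG , _ , K≡G∩H) _ _ →
    (λ _ → Fin.zero) ,
    λ x y Kxy _ →
      A⊆Edgeless G AG x y (E-⊆ (⊆G-trans (SameGraph⇒⊆G {K} K≡G∩H) (∩G-⊆ˡ G H)) x y Kxy)

GraphUnion₂ : Class → Class → Class
GraphUnion₂ A₁ A₂ K =
  Σ Graph λ G₁ → Σ Graph λ G₂ → A₁ G₁ × A₂ G₂ × SameGraph K (G₁ ∪G G₂)

GraphUnion₂-guarding : ∀ A₁ A₂ → Guarding A₁ → Guarding A₂ → Guarding (GraphUnion₂ A₁ A₂)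
GraphUnion₂-guarding A₁ A₂ guard₁ guard₂ B isB χB =
  (λ w → f₁ w * f₂ w) , (λ u v u≤v → *-mono-≤ (f₁-mono u v u≤v) (f₂-mono u v u≤v)) , colour
  where
  χ₁ = guard₁ B isB χB
  χ₂ = guard₂ B isB χB
  f₁ = proj₁ χ₁
  f₂ = proj₁ χ₂
  f₁-mono = proj₁ (proj₂ χ₁)
  f₂-mono = proj₁ (proj₂ χ₂)

  colour : ∀ K → GraphIntersection (GraphUnion₂ A₁ A₂) B K → ∀ w → CliqueNumber K w →
           Colourable K (f₁ w * f₂ w)
  colour K (G , H , (G₁ , G₂ , A₁G₁ , A₂G₂ , G≡G₁∪G₂) , BH , K≡G∩H) w (_ , ¬K) =
    Colourable-* K (G₁ ∩G H) (G₂ ∩G H) (λ x y → ∩G-∪G-edge G₁ G₂ H ∘ E-⊆ K⊆G₁₂∩H x y)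
      (ChiBounded-colourable χ₁ (G₁ ∩G H) (G₁ , H , A₁G₁ , BH , SameGraph-refl (G₁ ∩G H))
         (¬K ∘ HasClique-mono K₁⊆K))
      (ChiBounded-colourable χ₂ (G₂ ∩G H) (G₂ , H , A₂G₂ , BH , SameGraph-refl (G₂ ∩G H))
         (¬K ∘ HasClique-mono K₂⊆K))
    where
    K⊆G∩H : K ⊆G (G ∩G H)
    K⊆G∩H = SameGraph⇒⊆G K≡G∩H
    G∩H⊆K : (G ∩G H) ⊆G K
    G∩H⊆K = SameGraph⇒⊇G K≡G∩H
    G⊆G₁∪G₂ : G ⊆G (G₁ ∪G G₂)
    G⊆G₁∪G₂ = SameGraph⇒⊆G G≡G₁∪G₂
    G₁∪G₂⊆G : (G₁ ∪G G₂) ⊆G G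
    G₁∪G₂⊆G = SameGraph⇒⊇G G≡G₁∪G₂
    K⊆G₁₂∩H : K ⊆G ((G₁ ∪G G₂) ∩G H)
    K⊆G₁₂∩H = ⊆G-trans K⊆G∩H (∩G-monoˡ H G⊆G₁∪G₂)
    G₁₂∩H⊆K : ((G₁ ∪G G₂) ∩G H) ⊆G K
    G₁₂∩H⊆K = ⊆G-trans (∩G-monoˡ H G₁∪G₂⊆G) G∩H⊆K
    K₁⊆K : (G₁ ∩G H) ⊆G K
    K₁⊆K = ⊆G-trans (∩G-monoˡ H (∪G-⊆ˡ G₁ G₂)) G₁₂∩H⊆K
    K₂⊆K : (G₂ ∩G H) ⊆G K
    K₂⊆K = ⊆G-trans (∩G-monoˡ H (∪G-⊆ʳ G₁ G₂)) G₁₂∩H⊆K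

GraphUnion-zero-edgeless : (Cs : Fin 0 → Class) → GraphUnion 0 Cs ⊆′ Edgeless
GraphUnion-zero-edgeless _ _ (_ , _ , _ , K≡∅) x y Kxy with trans (sym (K≡∅ x y)) Kxy
... | ()

GraphUnion-suc-⊆ : ∀ t (Cs : Fin (suc t) → Class) →
  GraphUnion (suc t) Cs ⊆′ GraphUnion₂ (Cs Fin.zero) (GraphUnion t (Cs ∘ Fin.suc))
GraphUnion-suc-⊆ t _ _ (Gs , CsGs , K≡⋃Gs) =
  Gs Fin.zero , ⋃G t (Gs ∘ Fin.suc) , CsGs Fin.zero ,
  (Gs ∘ Fin.suc , CsGs ∘ Fin.suc , SameGraph-refl (⋃G t (Gs ∘ Fin.suc))) , K≡⋃Gs

GraphUnion-guarding : ∀ t (Cs : Fin t → Class) → (∀ i → Guarding (Cs i)) →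
  Guarding (GraphUnion t Cs)
GraphUnion-guarding zero Cs _ =
  Edgeless-guarding (GraphUnion 0 Cs) (GraphUnion-zero-edgeless Cs)
GraphUnion-guarding (suc t) Cs guard =
  Guarding-⊆ (GraphUnion (suc t) Cs) (GraphUnion₂ (Cs Fin.zero) tail)
    (GraphUnion-suc-⊆ t Cs)
    (GraphUnion₂-guarding (Cs Fin.zero) tail (guard Fin.zero)
      (GraphUnion-guarding t (Cs ∘ Fin.suc) (guard ∘ Fin.suc)))
  where
  tail : Class
  tail = GraphUnion t (Cs ∘ Fin.suc)

proposition3p9 : (t : ℕ) (Cs : Fin t → Class) →
    (∀ i → IsGraphClass (Cs i)) →
    (∀ i → IntersectionwiseChiGuarding (Cs i)) →
    IntersectionwiseChiGuarding (GraphUnion t Cs)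
proposition3p9 t Cs _ = GraphUnion-guarding t Cs
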